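{- Let $t\ge 1$. Every voltage graph $G_{4t+2}$ obtained from the tree $T_{4t+2}$ by adding arcs, each joining a leaf of $X_t$ (other than $x^{*}$) to a leaf of $Y_t$ (other than $y^{*}$), is bipartite (as an undirected multigraph).
   Context: The tree $X_t$: take a vertex $x^{*}$ adjacent to a vertex $x$, and a complete binary tree rooted at $x$ whose vertices are $x_b$ for bit strings $b$ of length $0\le|b|\le 2t-1$ ($x_\emptyset=x$, children of $x_b$ are $x_{b0},x_{b1}$). Let $a=0^{t-1}$ and delete the vertex $x_{0^{t}}$ together with all its descendants; the remaining leaves other than $x^{*}$ have bit strings of length $2t-1$. $Y_t$ is an identical copy with $x$ replaced by $y$. $T_{4t+2}$ is obtained from $X_t$ and $Y_t$ by adding the edge $x_ay_a$. -}

module Defs where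

open import Data.Nat using (ℕ; _*_; _∸_; _≤_)
open import Data.Bool using (Bool; false)
open import Data.List using (List; []; _∷_; _++_; length; replicate)
open import Data.Product using (Σ; ∃; _×_; _,_)
open import Data.Sum using (_⊎_)
open import Relation.Nullary using (¬_)
open import Relation.Binary.PropositionalEquality using (_≡_; _≢_)
open import Data.List.Membership.Propositional using (_∈_)

HasPrefix : List Bool → List Bool → Set
HasPrefix p b = ∃ λ s → p ++ s ≡ b

data Side : Set where
  sX sY : Side

-- bit string b (false = 0, true = 1) labels a vertex of the truncated binary
-- tree: |b| ≤ 2t-1 and b is not in the deleted subtree of x_{0^t}
InTree : ℕ → List Bool → Set
InTree t b = length b ≤ 2 * t ∸ 1 × ¬ HasPrefix (replicate t false) b

-- vertices of T_{4t+2}:  star s = x* / y*,  node s b = x_b / y_b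
data Vtx (t : ℕ) : Set where
  star : Side → Vtx t
  node : Side → (b : List Bool) → InTree t b → Vtx t

aStr : ℕ → List Bool
aStr t = replicate (t ∸ 1) false

-- edges of the tree T_{4t+2} (each undirected edge listed once)
data TreeEdge (t : ℕ) : Vtx t → Vtx t → Set where
  star-edge  : ∀ s p → TreeEdge t (star s) (node s [] p)
  child-edge : ∀ s b c p q → TreeEdge t (node s b p) (node s (b ++ c ∷ []) q)
  bridge     : ∀ p q → TreeEdge t (node sX (aStr t) p) (node sY (aStr t) q)

-- an added arc (with voltage in V) from a leaf x_{bx} of X_t (other than x*)
-- to a leaf y_{by} of Y_t (other than y*); leaves are the remaining x_b with |b| = 2t-1
record Arc (t : ℕ) (V : Set) : Set where
  constructor arc
  field
    bx by : List Bool
    px    : InTree t bx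
    py    : InTree t by
    lx    : length bx ≡ 2 * t ∸ 1
    ly    : length by ≡ 2 * t ∸ 1
    volt  : V

-- underlying undirected multigraph of G_{4t+2}: edge relation
-- (tree edges plus the added arcs, listed in some orientation)
GEdge : (t : ℕ) {V : Set} → List (Arc t V) → Vtx t → Vtx t → Set
GEdge t arcs u v =
  TreeEdge t u v ⊎
  Σ (Arc t _) λ e → e ∈ arcs ×
    (u ≡ node sX (Arc.bx e) (Arc.px e) × v ≡ node sY (Arc.by e) (Arc.py e))

Bipartite : {W : Set} → (W → W → Set) → Set
Bipartite {W} E = ∃ λ (col : W → Bool) → ∀ u v → E u v → col u ≢ col v

{-# OPTIONS --safe #-}
-- Colour a vertex by the parity of its depth, flipped on the Y side, and let
-- x*, y* sit at depth −1.  Tree edges change depth by one inside a side, and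
-- the bridge x_a y_a changes side at equal depth.  Every added arc joins leaves
-- of the same depth 2t − 1 on opposite sides, so it is properly coloured too.
module Submission where

open import Defs
open import Data.Nat using (ℕ; _≤_; zero; suc; _+_)
open import Data.Nat.Properties using (+-comm)
open import Data.List using (List; []; _∷_; _++_; length)
open import Data.List.Properties using (length-++)
open import Data.Bool using (Bool; true; false; not)
open import Data.Bool.Properties using (not-¬)
open import Data.Product using (_,_)
open import Data.Sum using (inj₁; inj₂)
open import Relation.Binary.PropositionalEquality
  using (_≡_; _≢_; refl; sym; trans; cong; subst)

parity : ℕ → Bool
parity zero    = false
parity (suc n) = not (parity n)

onSide : Side → Bool → Bool
onSide sX x = x
onSide sY x = not x

depthColour : ∀ {t} → Vtx t → Bool
depthColour (star s)     = onSide s true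
depthColour (node s b _) = onSide s (parity (length b))

x≢not-x : ∀ x → x ≢ not x
x≢not-x x = not-¬ refl

onSide-≢-not : ∀ s x → onSide s x ≢ onSide s (not x)
onSide-≢-not sX x = x≢not-x x
onSide-≢-not sY x = x≢not-x (not x)

onSide-sX≢sY : ∀ x → onSide sX x ≢ onSide sY x
onSide-sX≢sY = x≢not-x

parity-snoc : ∀ (b : List Bool) c → parity (length (b ++ c ∷ [])) ≡ not (parity (length b))
parity-snoc b c = cong parity (trans (length-++ b) (+-comm (length b) 1))

depthColour-proper : ∀ {t V} (arcs : List (Arc t V)) u v →
  GEdge t arcs u v → depthColour u ≢ depthColour v
depthColour-proper _ _ _ (inj₁ (star-edge sX p)) ()
depthColour-proper _ _ _ (inj₁ (star-edge sY p)) ()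
depthColour-proper _ _ _ (inj₁ (child-edge s b c p q)) eq =
  onSide-≢-not s (parity (length b))
    (subst (λ x → onSide s (parity (length b)) ≡ onSide s x) (parity-snoc b c) eq)
depthColour-proper {t} _ _ _ (inj₁ (bridge p q)) =
  onSide-sX≢sY (parity (length (aStr t)))
depthColour-proper _ _ _ (inj₂ (e , _ , refl , refl)) eq =
  onSide-sX≢sY (parity (length (Arc.bx e)))
    (subst (λ n → parity (length (Arc.bx e)) ≡ not (parity n))
           (trans (Arc.ly e) (sym (Arc.lx e))) eq)

lemma6 : (t : ℕ) → 1 ≤ t → (V : Set) → (arcs : List (Arc t V)) →
    Bipartite (GEdge t arcs)
-- The colouring works for every t.
lemma6 t _ V arcs = depthColour , depthColour-proper arcs
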